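{- Let $\mathcal{X}=\{x_1,\dots,x_N\}\subset\mathbb{R}^d$ be a finite dataset equipped with a metric $d$. The family of $k$-nearest-neighbor cluster sets $\{\mathcal{C}_i^k\}_{i=1}^{I_k}$, $k=0,1,\dots$ (defined in the context), forms a hierarchical clustering of $\mathcal{X}$: at the bottom layer $I_0=N$ and the clusters are the individual samples, $\mathcal{C}_i^0=\{x_i\}$ for $i\in\{1,\dots,N\}$ (up to relabeling); for each $k$, every cluster $\mathcal{C}_i^{k+1}$ is a union of clusters $\mathcal{C}_j^k$; and there exists some $k^*$ such that the top layer has $I_{k^*}=1$ cluster, namely $\mathcal{C}_1^{k^*}=\mathcal{X}$.
   Context: For $x\in\mathcal{X}$, order the points of $\mathcal{X}\setminus\{x\}$ by nondecreasing distance $d(x,\cdot)$ (ties broken by a fixed rule), and let $\mathcal{N}_k(x)$ be the set of the first $k$ points in this order (the $k$ nearest neighbors of $x$; $\mathcal{N}_0(x)=\emptyset$), for $0\le k\le N-1$. The $k$-nearest-neighbor cluster set $\{\mathcal{C}_i^k\}_{i=1}^{I_k}$ is a partition of $\mathcal{X}$ into pairwise disjoint sets whose union is $\mathcal{X}$, such that each cluster contains the $k$ nearest neighbors of every one of its elements ($\mathcal{N}_k(x)\subseteq\mathcal{C}_i^k$ for all $x\in\mathcal{C}_i^k$), and $I_k$ is the maximum number of clusters among all partitions with this property. -}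

module Defs where

open import Level using (Level; _⊔_)
open import Data.Nat using (ℕ; suc; _≤_; _<_)
open import Data.Fin using (Fin; _≟_)
open import Data.List using (List; take; filter; allFin)
open import Data.List.Membership.Propositional using (_∈_)
open import Data.List.Relation.Binary.Permutation.Propositional using (_↭_)
open import Data.List.Relation.Unary.Linked using (Linked)
open import Data.Product using (_×_; ∃)
open import Relation.Nullary using (¬?)
open import Relation.Binary.Bundles using (TotalOrder)
open import Relation.Binary.PropositionalEquality using (_≡_)

-- The dataset X = {x_1,...,x_N} is represented by its index set Fin N.
-- Distances take values in a totally ordered carrier:
-- d : Fin N → Fin N → Carrier O.

others : ∀ {N} → Fin N → List (Fin N)
others {N} x = filter (λ y → ¬? (y ≟ x)) (allFin N)

-- nbr x is an ordering of X \ {x} by nondecreasing distance d(x,·),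
-- with ties broken by an arbitrary (fixed) rule.
IsNeighbourOrder : ∀ {a ℓ₁ ℓ₂} (O : TotalOrder a ℓ₁ ℓ₂) {N : ℕ} →
  (Fin N → Fin N → TotalOrder.Carrier O) → (Fin N → List (Fin N)) → Set ℓ₂
IsNeighbourOrder O d nbr =
  ∀ x → (nbr x ↭ others x) × Linked (λ a b → TotalOrder._≤_ O (d x a) (d x b)) (nbr x)

kNN : ∀ {N} → (Fin N → List (Fin N)) → ℕ → Fin N → List (Fin N)
kNN nbr k x = take k (nbr x)

-- A partition of X into I (nonempty, pairwise disjoint) clusters, given by
-- a labelling c : Fin N → Fin I that is onto (cluster i = c⁻¹(i)).
IsPartition : ∀ {N I} → (Fin N → Fin I) → Set
IsPartition {N} {I} c = ∀ (i : Fin I) → ∃ λ (x : Fin N) → c x ≡ i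

ContainsKNN : ∀ {N I} → (Fin N → List (Fin N)) → ℕ → (Fin N → Fin I) → Set
ContainsKNN nbr k c = ∀ x y → y ∈ kNN nbr k x → c y ≡ c x

IsKNNClusterSet : ∀ {N} → (Fin N → List (Fin N)) → ℕ → (I : ℕ) → (Fin N → Fin I) → Set
IsKNNClusterSet {N} nbr k I c =
  IsPartition c × ContainsKNN nbr k c ×
  (∀ (J : ℕ) (c′ : Fin N → Fin J) → IsPartition c′ → ContainsKNN nbr k c′ → J ≤ I)

-- Admissible labellings into J clusters can be enumerated, and J = 1 is always
-- admissible while J ≤ N, so a maximum I_k exists. If a maximal k-NN cluster set
-- C were not finer than some labelling C′ that also contains all k nearest
-- neighbours (e.g. a (k+1)-NN cluster set), then splitting one cluster of C along
-- C′ would give an admissible partition with I_k + 1 clusters. For k = 0 the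
-- constraint is empty, so the discrete partition is maximal; for k = N − 1 the
-- neighbourhoods are all of X, so only the trivial partition is admissible.
module Submission where

open import Defs
open import Data.Nat using (ℕ; suc; _≤_; _<_; s≤s; z≤n; >-nonZero⁻¹)
open import Data.Nat.Properties using (≤-antisym; ≤-refl; 1+n≰n; ≤∧≢⇒<; m<1+n⇒m≤n; n≤0⇒n≡0)
open import Data.Fin using (Fin; zero; suc; _≟_)
open import Data.Fin.Properties using (any?; all?; injective⇒≤; nonZeroIndex)
open import Data.List using (List; _∷_; take; length; allFin)
open import Data.List.Properties using (take-all; filter-notAll; length-tabulate)
open import Data.List.Membership.Propositional using (_∈_)
open import Data.List.Membership.Propositional.Properties using (∈-filter⁺; ∈-allFin)
open import Data.List.Relation.Unary.Any as Any using (here; there)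
open import Data.List.Relation.Binary.Permutation.Propositional using (_↭_; ↭-sym)
open import Data.List.Relation.Binary.Permutation.Propositional.Properties using (∈-resp-↭; ↭-length)
open import Data.Product using (_×_; _,_; proj₁; proj₂; ∃; ∃₂)
open import Data.Vec.Functional as Vector using (head; tail)
open import Function using (_∘_; id)
open import Relation.Binary.Bundles using (TotalOrder)
open import Relation.Binary.PropositionalEquality using (_≡_; _≢_; _≗_; refl; sym; trans; cong; subst)
open import Relation.Nullary using (Dec; yes; no; ¬_; ¬?; contradiction)
open import Relation.Nullary.Decidable using (_×-dec_; _→-dec_)
open import Relation.Unary using (Pred; Decidable)

∈-take⇒∈-take-suc : ∀ {A : Set} k (xs : List A) {y} → y ∈ take k xs → y ∈ take (suc k) xs
∈-take⇒∈-take-suc (suc k) (x ∷ xs) (here y≡x) = here y≡x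
∈-take⇒∈-take-suc (suc k) (x ∷ xs) (there y∈) = there (∈-take⇒∈-take-suc k xs y∈)

IsPartition⇒≤ : ∀ {N I} {c : Fin N → Fin I} → IsPartition c → I ≤ N
IsPartition⇒≤ {c = c} onto = injective⇒≤ {f = proj₁ ∘ onto} λ {i} {j} eq →
  trans (sym (proj₂ (onto i))) (trans (cong c eq) (proj₂ (onto j)))

IsPartition-const⇒≡1 : ∀ {n I} {c : Fin (suc n) → Fin I} →
  IsPartition c → (∀ x y → c x ≡ c y) → I ≡ 1
IsPartition-const⇒≡1 {c = c} onto const = ≤-antisym
  (injective⇒≤ {f = λ _ → zero {0}} λ {i} {j} _ →
    trans (sym (proj₂ (onto i))) (trans (const _ _) (proj₂ (onto j))))
  (>-nonZero⁻¹ _ {{nonZeroIndex (c zero)}})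

any-function? : ∀ {n m p} {P : Pred (Fin n → Fin m) p} →
  (∀ {f g} → f ≗ g → P f → P g) → Decidable P → Dec (∃ P)
any-function? {n = 0} resp P? with P? (λ ())
... | yes p = yes (_ , p)
... | no ¬p = no λ (f , pf) → ¬p (resp (λ ()) pf)
any-function? {n = suc n} {P = P} resp P?
  with any? (λ a → any-function? {P = P ∘ (a Vector.∷_)} resp′ (P? ∘ (a Vector.∷_)))
  where
  resp′ : ∀ {a} {f g : Fin n → _} → f ≗ g → P (a Vector.∷ f) → P (a Vector.∷ g)
  resp′ f≗g = resp λ { zero → refl ; (suc i) → f≗g i }
... | yes (_ , _ , p) = yes (_ , p)
... | no ¬p = no λ (f , pf) →
  ¬p (head f , tail f , resp (λ { zero → refl ; (suc i) → refl }) pf)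

greatest-≤ : ∀ {q} {Q : Pred ℕ q} → Decidable Q → ∀ n → ∃ (λ j → j ≤ n × Q j) →
  ∃ λ i → Q i × (∀ j → Q j → j ≤ n → j ≤ i)
greatest-≤ Q? n (j , j≤n , qj) with Q? n
... | yes qn = n , qn , λ _ _ j≤n → j≤n
greatest-≤ {Q = Q} Q? 0 (j , j≤0 , qj) | no ¬q0 = contradiction (subst Q (n≤0⇒n≡0 j≤0) qj) ¬q0
greatest-≤ {Q = Q} Q? (suc m) (j , j≤n , qj) | no ¬qn =
  let i , qi , max = greatest-≤ Q? m (j , below qj j≤n , qj)
  in  i , qi , λ j qj j≤n → max j qj (below qj j≤n)
  where
  below : ∀ {j} → Q j → j ≤ suc m → j ≤ m
  below qj j≤n = m<1+n⇒m≤n (≤∧≢⇒< j≤n λ { refl → ¬qn qj })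

module SplitOff {N I p} (c : Fin N → Fin I) {S : Pred (Fin N) p} (S? : Decidable S) where

  splitOff : Fin N → Fin (suc I)
  splitOff z with S? z
  ... | yes _ = zero
  ... | no _  = suc (c z)

  splitOff-yes : ∀ {z} → S z → splitOff z ≡ zero
  splitOff-yes {z} Sz with S? z
  ... | yes _  = refl
  ... | no ¬Sz = contradiction Sz ¬Sz

  splitOff-no : ∀ {z} → ¬ S z → splitOff z ≡ suc (c z)
  splitOff-no {z} ¬Sz with S? z
  ... | yes Sz = contradiction Sz ¬Sz
  ... | no _   = refl

  splitOff-cong : ∀ {x y} → c x ≡ c y → (S x → S y) → (S y → S x) → splitOff x ≡ splitOff y
  splitOff-cong {x} {y} cx≡cy Sx→Sy Sy→Sx with S? x | S? y
  ... | yes _  | yes _  = refl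
  ... | no _   | no _   = cong suc cx≡cy
  ... | yes Sx | no ¬Sy = contradiction (Sx→Sy Sx) ¬Sy
  ... | no ¬Sx | yes Sy = contradiction (Sy→Sx Sy) ¬Sx

  splitOff-partition : ∀ {x y} → IsPartition c → S y → ¬ S x → (∀ z → S z → c z ≡ c x) →
    IsPartition splitOff
  splitOff-partition _ Sy _ _ zero = _ , splitOff-yes Sy
  splitOff-partition {x} onto _ ¬Sx S⊆[x] (suc i) with w , cw≡i ← onto i | S? w
  ... | yes Sw = x , trans (splitOff-no ¬Sx) (cong suc (trans (sym (S⊆[x] w Sw)) cw≡i))
  ... | no ¬Sw = w , trans (splitOff-no ¬Sw) (cong suc cw≡i)

module _ {N : ℕ} (nbr : Fin N → List (Fin N)) where

  open import Data.List.Membership.DecPropositional (_≟_ {N}) using (_∈?_)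

  IsAdmissible : ℕ → ∀ {I} → (Fin N → Fin I) → Set
  IsAdmissible k c = IsPartition c × ContainsKNN nbr k c

  IsAdmissible? : ∀ k {I} → Decidable (IsAdmissible k {I})
  IsAdmissible? k c = all? (λ i → any? (λ x → c x ≟ i))
    ×-dec all? (λ x → all? (λ y → (y ∈? kNN nbr k x) →-dec (c y ≟ c x)))

  IsAdmissible-resp-≗ : ∀ {k I} {c c′ : Fin N → Fin I} → c ≗ c′ → IsAdmissible k c → IsAdmissible k c′
  IsAdmissible-resp-≗ c≗c′ (onto , knn) =
    (λ i → let x , cx≡i = onto i in x , trans (sym (c≗c′ x)) cx≡i) ,
    (λ x y y∈ → trans (sym (c≗c′ y)) (trans (knn x y y∈) (c≗c′ x)))

  ∃-IsAdmissible? : ∀ k → Decidable (λ I → ∃ (IsAdmissible k {I}))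
  ∃-IsAdmissible? k I = any-function? IsAdmissible-resp-≗ (IsAdmissible? k)

  knnClusterSet-exists : 1 ≤ N → ∀ k → ∃₂ λ I c → IsKNNClusterSet nbr k I c
  knnClusterSet-exists (s≤s z≤n) k =
    let I , (c , onto , knn) , max = greatest-≤ (∃-IsAdmissible? k) N (1 , s≤s z≤n , single)
    in  I , c , onto , knn , λ J c′ onto′ knn′ → max J (c′ , onto′ , knn′) (IsPartition⇒≤ onto′)
    where
    single : ∃ (IsAdmissible k {1})
    single = (λ _ → zero) , (λ { zero → zero , refl }) , λ _ _ _ → refl

  ContainsKNN-zero : ∀ {I} (c : Fin N → Fin I) → ContainsKNN nbr 0 c
  ContainsKNN-zero _ _ _ ()

  ContainsKNN-suc⇒ContainsKNN : ∀ {k I} {c : Fin N → Fin I} → ContainsKNN nbr (suc k) c → ContainsKNN nbr k c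
  ContainsKNN-suc⇒ContainsKNN {k} knn x y y∈ = knn x y (∈-take⇒∈-take-suc k (nbr x) y∈)

  knnClusterSet-finer : ∀ {k I J} {c : Fin N → Fin I} {c′ : Fin N → Fin J} →
    IsKNNClusterSet nbr k I c → ContainsKNN nbr k c′ → ∀ x y → c x ≡ c y → c′ x ≡ c′ y
  knnClusterSet-finer {k} {I} {c = c} {c′} (onto , knn , max) knn′ x y cx≡cy with c′ x ≟ c′ y
  ... | yes c′x≡c′y = c′x≡c′y
  ... | no c′x≢c′y = contradiction
    (max (suc I) splitOff (splitOff-partition onto Sy ¬Sx (λ _ → proj₁)) splitOff-knn) 1+n≰n
    where
    S : Pred (Fin N) _
    S z = c z ≡ c x × c′ z ≢ c′ x
    open SplitOff c {S = S} (λ z → (c z ≟ c x) ×-dec ¬? (c′ z ≟ c′ x))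
    Sy : S y
    Sy = sym cx≡cy , c′x≢c′y ∘ sym
    ¬Sx : ¬ S x
    ¬Sx (_ , c′x≢c′x) = c′x≢c′x refl
    S-resp : ∀ {u v} → c u ≡ c v → c′ u ≡ c′ v → S u → S v
    S-resp cu≡cv c′u≡c′v (cu≡cx , c′u≢c′x) = trans (sym cu≡cv) cu≡cx , c′u≢c′x ∘ trans c′u≡c′v
    splitOff-knn : ContainsKNN nbr k splitOff
    splitOff-knn u v v∈ = splitOff-cong (knn u v v∈)
      (S-resp (knn u v v∈) (knn′ u v v∈)) (S-resp (sym (knn u v v∈)) (sym (knn′ u v v∈)))

  knnClusterSet-zero : ∀ {I} {c : Fin N → Fin I} → IsKNNClusterSet nbr 0 I c →
    I ≡ N × (∀ x y → c x ≡ c y → x ≡ y)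
  knnClusterSet-zero cs@(onto , _ , max) =
    ≤-antisym (IsPartition⇒≤ onto) (max N id (λ i → i , refl) (ContainsKNN-zero id)) ,
    knnClusterSet-finer {k = 0} cs (ContainsKNN-zero id)

length-others : ∀ {N} (x : Fin N) → length (others x) < N
length-others {N} x = subst (length (others x) <_) (length-tabulate id)
  (filter-notAll (λ y → ¬? (y ≟ x)) (allFin N) (Any.map (λ x≡y y≢x → y≢x (sym x≡y)) (∈-allFin x)))

module _ {n} (nbr : Fin (suc n) → List (Fin (suc n))) (nbr↭others : ∀ x → nbr x ↭ others x) where

  length-nbr≤n : ∀ x → length (nbr x) ≤ n
  length-nbr≤n x = m<1+n⇒m≤n (subst (_< suc n) (sym (↭-length (nbr↭others x))) (length-others x))

  ∈-kNN-last : ∀ {x y} → y ≢ x → y ∈ kNN nbr n x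
  ∈-kNN-last {x} {y} y≢x rewrite take-all n (nbr x) (length-nbr≤n x) =
    ∈-resp-↭ (↭-sym (nbr↭others x)) (∈-filter⁺ (λ z → ¬? (z ≟ x)) (∈-allFin y) y≢x)

  ContainsKNN-last⇒const : ∀ {I} {c : Fin (suc n) → Fin I} → ContainsKNN nbr n c → ∀ x y → c x ≡ c y
  ContainsKNN-last⇒const knn x y with y ≟ x
  ... | yes refl = refl
  ... | no y≢x   = sym (knn x y (∈-kNN-last y≢x))

  knnClusterSet-last : ∀ {I} {c : Fin (suc n) → Fin I} → IsKNNClusterSet nbr n I c → I ≡ 1
  knnClusterSet-last (onto , knn , _) = IsPartition-const⇒≡1 onto (ContainsKNN-last⇒const knn)

theorem1 : ∀ {a ℓ₁ ℓ₂} (O : TotalOrder a ℓ₁ ℓ₂) (N : ℕ) → 1 ≤ N →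
    (d : Fin N → Fin N → TotalOrder.Carrier O) →
    (∀ x y → TotalOrder._≈_ O (d x y) (d y x)) →
    (nbr : Fin N → List (Fin N)) → IsNeighbourOrder O d nbr →
    ((k : ℕ) → k < N → ∃₂ λ (I : ℕ) (c : Fin N → Fin I) → IsKNNClusterSet nbr k I c)
    × (∀ (I : ℕ) (c : Fin N → Fin I) → IsKNNClusterSet nbr 0 I c →
        I ≡ N × (∀ x y → c x ≡ c y → x ≡ y))
    × (∀ (k : ℕ) → suc k < N →
        ∀ (I : ℕ) (c : Fin N → Fin I) (J : ℕ) (c′ : Fin N → Fin J) →
        IsKNNClusterSet nbr k I c → IsKNNClusterSet nbr (suc k) J c′ →
        ∀ x y → c x ≡ c y → c′ x ≡ c′ y)
    × (∃ λ (kstar : ℕ) → kstar < N ×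
        (∀ (I : ℕ) (c : Fin N → Fin I) → IsKNNClusterSet nbr kstar I c → I ≡ 1))
theorem1 O (suc n) 1≤N d _ nbr order =
  (λ k _ → knnClusterSet-exists nbr 1≤N k) ,
  (λ _ _ → knnClusterSet-zero nbr) ,
  (λ _ _ _ _ _ _ cs (_ , knn′ , _) → knnClusterSet-finer nbr cs (ContainsKNN-suc⇒ContainsKNN nbr knn′)) ,
  (n , ≤-refl , λ _ _ → knnClusterSet-last nbr (proj₁ ∘ order))
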